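{- Let $a_1,\dots,a_n,b\in\mathbb{Z}$ with $(a_1,\dots,a_n)\neq 0$, and let $\mathcal H\subseteq\mathbb{R}^n$ be the hyperplane $\sum_{i=1}^n a_ix_i=b$. For $r>0$ let $\Delta(r)=\mathcal H\cap[-r,r]^n$ and $\Delta_1(r)=\Delta(r)\cap\mathbb{Z}^n$. Suppose $\mathcal H$ contains an integral point and let $r_0$ be the smallest positive integer such that $\Delta_1(r_0)\neq\emptyset$. Then for all $r\ge r_0$, \[|\Delta_1(r)|\ \ge\ \left\lfloor\frac{r-r_0}{\sum_{i=1}^n|a_i|}\right\rfloor^{n-1}.\] -}

module Defs where

open import Data.Nat as ℕ using (ℕ; zero; suc; _/_)
open import Data.Integer as ℤ using (ℤ; +_; ∣_∣)
open import Data.Vec using (Vec; []; _∷_; lookup)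
open import Data.Fin using (Fin)
open import Data.Product using (_×_; Σ; ∃)
open import Relation.Binary.PropositionalEquality using (_≡_)
open import Function.Definitions using (Injective)

dot : ∀ {n} → Vec ℤ n → Vec ℤ n → ℤ
dot []       []       = + 0
dot (a ∷ as) (x ∷ xs) = a ℤ.* x ℤ.+ dot as xs

sumAbs : ∀ {n} → Vec ℤ n → ℕ
sumAbs []       = 0
sumAbs (a ∷ as) = ∣ a ∣ ℕ.+ sumAbs as

-- floor division on ℕ; the value at divisor 0 is an irrelevant convention
floorDiv : ℕ → ℕ → ℕ
floorDiv m zero    = 0
floorDiv m (suc k) = m / suc k

InΔ₁ : ∀ {n} → Vec ℤ n → ℤ → ℕ → Vec ℤ n → Set
InΔ₁ {n} a b r x = (∀ (i : Fin n) → ∣ lookup x i ∣ ℕ.≤ r) × dot a x ≡ b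

Δ₁-nonempty : ∀ {n} → Vec ℤ n → ℤ → ℕ → Set
Δ₁-nonempty {n} a b r = ∃ λ (x : Vec ℤ n) → InΔ₁ a b r x

CardΔ₁≥ : ∀ {n} → Vec ℤ n → ℤ → ℕ → ℕ → Set
CardΔ₁≥ {n} a b r m =
  Σ (Fin m → Vec ℤ n) λ f → Injective _≡_ _≡_ f × (∀ k → InΔ₁ a b r (f k))

{-# OPTIONS --safe #-}

-- Fix x⁰ ∈ Δ₁(r₀).  If a = (p , a') with p ≠ 0, then t ↦ (- a'·t , p t) maps the grid
-- {0,…,q-1}ⁿ⁻¹ injectively into the integer solutions of a·y = 0 with ‖y‖∞ ≤ q ∑|aᵢ|;
-- a zero leading coefficient instead leaves one coordinate free.  Translating by x⁰ puts
-- these qⁿ⁻¹ points into Δ₁(r₀ + q ∑|aᵢ|) ⊆ Δ₁(r) for q = ⌊(r - r₀) / ∑|aᵢ|⌋.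

module Submission where

open import Defs
open import Data.Nat as ℕ using (ℕ; zero; suc; _≤_; _<_; _∸_; _^_; z≤n)
import Data.Nat.Properties as ℕ
open import Data.Nat.DivMod using (m/n*n≤m)
open import Data.Integer as ℤ using (ℤ; +_; -_; ∣_∣)
import Data.Integer.Properties as ℤ
open import Algebra.Properties.AbelianGroup ℤ.+-0-abelianGroup
  using () renaming (∙-cancelˡ to +-cancelˡ)
open import Algebra.Properties.CommutativeSemigroup ℤ.+-commutativeSemigroup
  using () renaming (interchange to +-interchange)
open import Algebra.Properties.CommutativeSemigroup ℤ.*-commutativeSemigroup
  using () renaming (x∙yz≈y∙xz to *-left-comm)
open import Data.Vec using (Vec; []; _∷_; lookup; map; zipWith; tabulate)
open import Data.Vec.Properties
  using (∷-injectiveˡ; ∷-injectiveʳ; lookup-map; lookup-zipWith; lookup∘tabulate)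
open import Data.Fin using (Fin; zero; suc; toℕ; combine; finToFun; funToFin)
open import Data.Fin.Properties using (toℕ-injective; toℕ≤n; funToFin-finToFin)
open import Data.Product using (∃; _,_)
open import Data.Empty using (⊥-elim)
open import Function using (_∘_)
open import Function.Bundles using (_↣_; mk↣; Injection)
open import Function.Definitions using (Injective)
open import Relation.Nullary using (¬_; yes; no)
open import Relation.Binary.PropositionalEquality
  using (_≡_; _≢_; _≗_; refl; sym; trans; cong; cong₂; module ≡-Reasoning)

private
  variable
    m n q r s : ℕ
    A B : Set

-- Lets the left inverse funToFin of finToFun prove injectivity without the function
-- extensionality that Data.Fin.Properties.^↔→ assumes.
funToFin-cong : {f g : Fin m → Fin q} → f ≗ g → funToFin f ≡ funToFin g
funToFin-cong {zero}  _   = refl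
funToFin-cong {suc m} f≗g = cong₂ combine (f≗g zero) (funToFin-cong (f≗g ∘ suc))

tabulate-injective : {f g : Fin n → A} → tabulate f ≡ tabulate g → f ≗ g
tabulate-injective {f = f} {g} eq i = begin
  f i                   ≡⟨ lookup∘tabulate f i ⟨
  lookup (tabulate f) i ≡⟨ cong (λ v → lookup v i) eq ⟩
  lookup (tabulate g) i ≡⟨ lookup∘tabulate g i ⟩
  g i                   ∎
  where open ≡-Reasoning

Fin^↣Vec : Fin (q ^ m) ↣ Vec (Fin q) m
Fin^↣Vec {q} {m} = mk↣ injective
  where
  open ≡-Reasoning
  injective : Injective _≡_ _≡_ (tabulate ∘ finToFun {q} {m})
  injective {k} {l} eq = begin
    k                             ≡⟨ funToFin-finToFin {m} k ⟨
    funToFin (finToFun {q} {m} k) ≡⟨ funToFin-cong (tabulate-injective eq) ⟩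
    funToFin (finToFun {q} {m} l) ≡⟨ funToFin-finToFin {m} l ⟩
    l                             ∎

map-injective : {f : A → B} → Injective _≡_ _≡_ f → Injective _≡_ _≡_ (map {n = n} f)
map-injective f-inj {[]}    {[]}    _  = refl
map-injective f-inj {_ ∷ _} {_ ∷ _} eq =
  cong₂ _∷_ (f-inj (∷-injectiveˡ eq)) (map-injective f-inj (∷-injectiveʳ eq))

infixl 6 _+ᵛ_
infixr 7 _*ᵛ_

_+ᵛ_ : Vec ℤ n → Vec ℤ n → Vec ℤ n
_+ᵛ_ = zipWith ℤ._+_

_*ᵛ_ : ℤ → Vec ℤ n → Vec ℤ n
c *ᵛ x = map (c ℤ.*_) x

fromGrid : Vec (Fin q) n → Vec ℤ n
fromGrid = map (+_ ∘ toℕ)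

+ᵛ-cancelˡ : (x : Vec ℤ n) {y z : Vec ℤ n} → x +ᵛ y ≡ x +ᵛ z → y ≡ z
+ᵛ-cancelˡ []      {[]}    {[]}    _  = refl
+ᵛ-cancelˡ (c ∷ x) {a ∷ _} {b ∷ _} eq =
  cong₂ _∷_ (+-cancelˡ c a b (∷-injectiveˡ eq)) (+ᵛ-cancelˡ x (∷-injectiveʳ eq))

*ᵛ-cancelˡ : ∀ c .{{_ : ℤ.NonZero c}} → Injective _≡_ _≡_ (_*ᵛ_ {n} c)
*ᵛ-cancelˡ c = map-injective (ℤ.*-cancelˡ-≡ c _ _)

fromGrid-injective : Injective _≡_ _≡_ (fromGrid {q} {n})
fromGrid-injective = map-injective (toℕ-injective ∘ ℤ.+-injective)

dot-+ᵛ : (a x y : Vec ℤ n) → dot a (x +ᵛ y) ≡ dot a x ℤ.+ dot a y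
dot-+ᵛ []       []       []       = refl
dot-+ᵛ (a ∷ as) (x ∷ xs) (y ∷ ys) = begin
  a ℤ.* (x ℤ.+ y) ℤ.+ dot as (xs +ᵛ ys)
    ≡⟨ cong₂ ℤ._+_ (ℤ.*-distribˡ-+ a x y) (dot-+ᵛ as xs ys) ⟩
  (a ℤ.* x ℤ.+ a ℤ.* y) ℤ.+ (dot as xs ℤ.+ dot as ys)
    ≡⟨ +-interchange (a ℤ.* x) (a ℤ.* y) (dot as xs) (dot as ys) ⟩
  (a ℤ.* x ℤ.+ dot as xs) ℤ.+ (a ℤ.* y ℤ.+ dot as ys) ∎
  where open ≡-Reasoning

dot-*ᵛ : (a : Vec ℤ n) (c : ℤ) (x : Vec ℤ n) → dot a (c *ᵛ x) ≡ c ℤ.* dot a x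
dot-*ᵛ []       c []       = sym (ℤ.*-zeroʳ c)
dot-*ᵛ (a ∷ as) c (x ∷ xs) = begin
  a ℤ.* (c ℤ.* x) ℤ.+ dot as (c *ᵛ xs)
    ≡⟨ cong₂ ℤ._+_ (*-left-comm a c x) (dot-*ᵛ as c xs) ⟩
  c ℤ.* (a ℤ.* x) ℤ.+ c ℤ.* dot as xs
    ≡⟨ ℤ.*-distribˡ-+ c (a ℤ.* x) (dot as xs) ⟨
  c ℤ.* (a ℤ.* x ℤ.+ dot as xs) ∎
  where open ≡-Reasoning

InCube : ℕ → Vec ℤ n → Set
InCube {n} r x = ∀ (i : Fin n) → ∣ lookup x i ∣ ≤ r

InCube-∷ : ∀ {x : ℤ} {xs : Vec ℤ n} → ∣ x ∣ ≤ r → InCube r xs → InCube r (x ∷ xs)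
InCube-∷ x≤r _   zero    = x≤r
InCube-∷ _   xs∈ (suc i) = xs∈ i

InCube-mono : {x : Vec ℤ n} → r ≤ s → InCube r x → InCube s x
InCube-mono r≤s x∈ i = ℕ.≤-trans (x∈ i) r≤s

InCube-+ᵛ : {x y : Vec ℤ n} → InCube r x → InCube s y → InCube (r ℕ.+ s) (x +ᵛ y)
InCube-+ᵛ {r = r} {s} {x} {y} x∈ y∈ i = begin
  ∣ lookup (x +ᵛ y) i ∣              ≡⟨ cong ∣_∣ (lookup-zipWith ℤ._+_ i x y) ⟩
  ∣ lookup x i ℤ.+ lookup y i ∣      ≤⟨ ℤ.∣i+j∣≤∣i∣+∣j∣ (lookup x i) (lookup y i) ⟩
  ∣ lookup x i ∣ ℕ.+ ∣ lookup y i ∣ ≤⟨ ℕ.+-mono-≤ (x∈ i) (y∈ i) ⟩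
  r ℕ.+ s                            ∎
  where open ℕ.≤-Reasoning

InCube-*ᵛ : ∀ c {x : Vec ℤ n} → InCube r x → InCube (∣ c ∣ ℕ.* r) (c *ᵛ x)
InCube-*ᵛ {r = r} c {x} x∈ i = begin
  ∣ lookup (c *ᵛ x) i ∣      ≡⟨ cong ∣_∣ (lookup-map i (c ℤ.*_) x) ⟩
  ∣ c ℤ.* lookup x i ∣       ≡⟨ ℤ.abs-* c (lookup x i) ⟩
  ∣ c ∣ ℕ.* ∣ lookup x i ∣   ≤⟨ ℕ.*-monoʳ-≤ ∣ c ∣ (x∈ i) ⟩
  ∣ c ∣ ℕ.* r                ∎
  where open ℕ.≤-Reasoning

fromGrid-InCube : (t : Vec (Fin q) n) → InCube q (fromGrid t)
fromGrid-InCube t i rewrite lookup-map i (+_ ∘ toℕ) t = toℕ≤n (lookup t i)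

∣dot∣≤sumAbs* : (a x : Vec ℤ n) → InCube r x → ∣ dot a x ∣ ≤ sumAbs a ℕ.* r
∣dot∣≤sumAbs* []       []       _  = z≤n
∣dot∣≤sumAbs* {r = r} (a ∷ as) (x ∷ xs) x∈ = begin
  ∣ a ℤ.* x ℤ.+ dot as xs ∣
    ≤⟨ ℤ.∣i+j∣≤∣i∣+∣j∣ (a ℤ.* x) (dot as xs) ⟩
  ∣ a ℤ.* x ∣ ℕ.+ ∣ dot as xs ∣
    ≡⟨ cong (ℕ._+ ∣ dot as xs ∣) (ℤ.abs-* a x) ⟩
  ∣ a ∣ ℕ.* ∣ x ∣ ℕ.+ ∣ dot as xs ∣
    ≤⟨ ℕ.+-mono-≤ (ℕ.*-monoʳ-≤ ∣ a ∣ (x∈ zero)) (∣dot∣≤sumAbs* as xs (x∈ ∘ suc)) ⟩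
  ∣ a ∣ ℕ.* r ℕ.+ sumAbs as ℕ.* r
    ≡⟨ ℕ.*-distribʳ-+ r ∣ a ∣ (sumAbs as) ⟨
  (∣ a ∣ ℕ.+ sumAbs as) ℕ.* r ∎
  where open ℕ.≤-Reasoning

AllZero : Vec ℤ n → Set
AllZero {n} a = ∀ (i : Fin n) → lookup a i ≡ + 0

sumAbs≡0⇒AllZero : (a : Vec ℤ n) → sumAbs a ≡ 0 → AllZero a
sumAbs≡0⇒AllZero (p ∷ _)  eq zero    = ℤ.∣i∣≡0⇒i≡0 (ℕ.m+n≡0⇒m≡0 ∣ p ∣ eq)
sumAbs≡0⇒AllZero (p ∷ as) eq (suc i) =
  sumAbs≡0⇒AllZero as (ℕ.m+n≡0⇒n≡0 ∣ p ∣ eq) i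

m≤sumAbs*m : (a : Vec ℤ n) → ¬ AllZero a → m ≤ sumAbs a ℕ.* m
m≤sumAbs*m {m = m} a a≢0 =
  ℕ.m≤n*m m (sumAbs a) {{ℕ.≢-nonZero (a≢0 ∘ sumAbs≡0⇒AllZero a)}}

record Δ₁Embedding (A : Set) (a : Vec ℤ n) (b : ℤ) (r : ℕ) : Set where
  field
    embed           : A → Vec ℤ n
    embed-injective : Injective _≡_ _≡_ embed
    embed-InCube    : ∀ k → InCube r (embed k)
    embed-solves    : ∀ k → dot a (embed k) ≡ b

open Δ₁Embedding

module _ {a : Vec ℤ n} {b : ℤ} where

  Δ₁Embedding-mono : r ≤ s → Δ₁Embedding A a b r → Δ₁Embedding A a b s
  Δ₁Embedding-mono r≤s e = record
    { embed           = embed e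
    ; embed-injective = embed-injective e
    ; embed-InCube    = λ k → InCube-mono {x = embed e k} r≤s (embed-InCube e k)
    ; embed-solves    = embed-solves e
    }

  Δ₁Embedding-translate : ∀ {x} → InΔ₁ a b r x → Δ₁Embedding A a (+ 0) s →
                          Δ₁Embedding A a b (r ℕ.+ s)
  Δ₁Embedding-translate {x = x} (x∈ , ax≡b) e = record
    { embed           = λ k → x +ᵛ embed e k
    ; embed-injective = embed-injective e ∘ +ᵛ-cancelˡ x
    ; embed-InCube    = λ k → InCube-+ᵛ {x = x} {embed e k} x∈ (embed-InCube e k)
    ; embed-solves    = λ k → solves (embed-solves e k)
    }
    where
    solves : ∀ {y} → dot a y ≡ + 0 → dot a (x +ᵛ y) ≡ b
    solves {y} ay≡0 = begin
      dot a (x +ᵛ y)        ≡⟨ dot-+ᵛ a x y ⟩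
      dot a x ℤ.+ dot a y   ≡⟨ cong₂ ℤ._+_ ax≡b ay≡0 ⟩
      b ℤ.+ + 0             ≡⟨ ℤ.+-identityʳ b ⟩
      b                     ∎
      where open ≡-Reasoning

  Δ₁Embedding⇒CardΔ₁≥ : Fin m ↣ A → Δ₁Embedding A a b r → CardΔ₁≥ a b r m
  Δ₁Embedding⇒CardΔ₁≥ g e =
    embed e ∘ to ,
    injective ∘ embed-injective e ,
    λ k → embed-InCube e (to k) , embed-solves e (to k)
    where open Injection g

pivotGrid : ∀ q p (as : Vec ℤ n) → p ≢ + 0 →
            Δ₁Embedding (Vec (Fin q) n) (p ∷ as) (+ 0) (sumAbs (p ∷ as) ℕ.* q)
pivotGrid {n} q p as p≢0 = record
  { embed           = point
  ; embed-injective = fromGrid-injective ∘ *ᵛ-cancelˡ p ∘ ∷-injectiveʳ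
  ; embed-InCube    = point-InCube
  ; embed-solves    = point-solves
  }
  where
  instance
    p-nonZero : ℤ.NonZero p
    p-nonZero = ℤ.≢-nonZero p≢0

  point : Vec (Fin q) n → Vec ℤ (suc n)
  point t = - dot as (fromGrid t) ∷ p *ᵛ fromGrid t

  point-solves : ∀ t → dot (p ∷ as) (point t) ≡ + 0
  point-solves t = begin
    p ℤ.* - D ℤ.+ dot as (p *ᵛ fromGrid t)
      ≡⟨ cong₂ ℤ._+_ (sym (ℤ.neg-distribʳ-* p D)) (dot-*ᵛ as p (fromGrid t)) ⟩
    - (p ℤ.* D) ℤ.+ p ℤ.* D
      ≡⟨ ℤ.+-inverseˡ (p ℤ.* D) ⟩
    + 0 ∎
    where
    open ≡-Reasoning
    D = dot as (fromGrid t)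

  point-InCube : ∀ t → InCube (sumAbs (p ∷ as) ℕ.* q) (point t)
  point-InCube t = InCube-∷ head (InCube-mono {x = p *ᵛ fromGrid t} ∣p∣q≤ tail)
    where
    tail : InCube (∣ p ∣ ℕ.* q) (p *ᵛ fromGrid t)
    tail = InCube-*ᵛ p {fromGrid t} (fromGrid-InCube t)
    ∣p∣q≤ : ∣ p ∣ ℕ.* q ≤ sumAbs (p ∷ as) ℕ.* q
    ∣p∣q≤ = ℕ.*-monoˡ-≤ q (ℕ.m≤m+n ∣ p ∣ (sumAbs as))
    head : ∣ - dot as (fromGrid t) ∣ ≤ sumAbs (p ∷ as) ℕ.* q
    head = begin
      ∣ - dot as (fromGrid t) ∣ ≡⟨ ℤ.∣-i∣≡∣i∣ (dot as (fromGrid t)) ⟩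
      ∣ dot as (fromGrid t) ∣   ≤⟨ ∣dot∣≤sumAbs* as (fromGrid t) (fromGrid-InCube t) ⟩
      sumAbs as ℕ.* q           ≤⟨ ℕ.*-monoˡ-≤ q (ℕ.m≤n+m (sumAbs as) ∣ p ∣) ⟩
      sumAbs (p ∷ as) ℕ.* q     ∎
      where open ℕ.≤-Reasoning

freeCoordinateGrid : ∀ {as : Vec ℤ n} → q ≤ s →
                     Δ₁Embedding (Vec (Fin q) m) as (+ 0) s →
                     Δ₁Embedding (Vec (Fin q) (suc m)) (+ 0 ∷ as) (+ 0) s
freeCoordinateGrid {n} {q} {s} {m} {as} q≤s e = record
  { embed           = point
  ; embed-injective = point-injective
  ; embed-InCube    = point-InCube
  ; embed-solves    = point-solves
  }
  where
  point : Vec (Fin q) (suc m) → Vec ℤ (suc n)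
  point (i ∷ t) = + toℕ i ∷ embed e t

  point-injective : Injective _≡_ _≡_ point
  point-injective {_ ∷ _} {_ ∷ _} eq = cong₂ _∷_
    (toℕ-injective (ℤ.+-injective (∷-injectiveˡ eq)))
    (embed-injective e (∷-injectiveʳ eq))

  point-InCube : ∀ t → InCube s (point t)
  point-InCube (i ∷ t) =
    InCube-∷ {xs = embed e t} (ℕ.≤-trans (toℕ≤n i) q≤s) (embed-InCube e t)

  point-solves : ∀ t → dot (+ 0 ∷ as) (point t) ≡ + 0
  point-solves (i ∷ t) = trans (ℤ.+-identityˡ (dot as (embed e t))) (embed-solves e t)

kernelGrid : ∀ q (a : Vec ℤ (suc n)) → ¬ AllZero a →
             Δ₁Embedding (Vec (Fin q) n) a (+ 0) (sumAbs a ℕ.* q)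
kernelGrid q (p ∷ as) a≢0 with p ℤ.≟ + 0
kernelGrid q (p ∷ as)         a≢0 | no p≢0  = pivotGrid q p as p≢0
kernelGrid q (_ ∷ [])         a≢0 | yes refl = ⊥-elim (a≢0 λ { zero → refl })
kernelGrid q (_ ∷ as@(_ ∷ _)) a≢0 | yes refl =
  freeCoordinateGrid (m≤sumAbs*m as as≢0) (kernelGrid q as as≢0)
  where
  as≢0 : ¬ AllZero as
  as≢0 as≡0 = a≢0 λ { zero → refl ; (suc i) → as≡0 i }

n*floorDiv[m,n]≤m : ∀ m n → n ℕ.* floorDiv m n ≤ m
n*floorDiv[m,n]≤m m zero    = z≤n
n*floorDiv[m,n]≤m m (suc n) = begin
  suc n ℕ.* (m ℕ./ suc n) ≡⟨ ℕ.*-comm (suc n) (m ℕ./ suc n) ⟩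
  m ℕ./ suc n ℕ.* suc n   ≤⟨ m/n*n≤m m (suc n) ⟩
  m                       ∎
  where open ℕ.≤-Reasoning

r+s*floorDiv[t∸r,s]≤t : ∀ {r t} s → r ≤ t → r ℕ.+ s ℕ.* floorDiv (t ∸ r) s ≤ t
r+s*floorDiv[t∸r,s]≤t {r} {t} s r≤t = begin
  r ℕ.+ s ℕ.* floorDiv (t ∸ r) s ≤⟨ ℕ.+-monoʳ-≤ r (n*floorDiv[m,n]≤m (t ∸ r) s) ⟩
  r ℕ.+ (t ∸ r)                  ≡⟨ ℕ.m+[n∸m]≡n r≤t ⟩
  t                              ∎
  where open ℕ.≤-Reasoning

corollary2p3 : (n : ℕ) (a : Vec ℤ n) (b : ℤ)
    → ¬ (∀ (i : Fin n) → lookup a i ≡ + 0)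
    → (∃ λ (x : Vec ℤ n) → dot a x ≡ b)
    → (r₀ : ℕ) → 1 ≤ r₀ → Δ₁-nonempty a b r₀
    → (∀ (s : ℕ) → 1 ≤ s → s < r₀ → ¬ Δ₁-nonempty a b s)
    → (r : ℕ) → r₀ ≤ r
    → CardΔ₁≥ a b r (floorDiv (r ∸ r₀) (sumAbs a) ^ (n ∸ 1))
-- Only x⁰ ∈ Δ₁(r₀) is used.
corollary2p3 zero    a b a≢0 _ _  _ _             _ _ _    = ⊥-elim (a≢0 λ ())
corollary2p3 (suc n) a b a≢0 _ r₀ _ (x , x∈Δ₁r₀) _ r r₀≤r =
  Δ₁Embedding⇒CardΔ₁≥ Fin^↣Vec
    (Δ₁Embedding-mono (r+s*floorDiv[t∸r,s]≤t (sumAbs a) r₀≤r)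
      (Δ₁Embedding-translate x∈Δ₁r₀
        (kernelGrid (floorDiv (r ∸ r₀) (sumAbs a)) a a≢0)))
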